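{- Let $G$ be a finite abelian group of order $n\ge 2$, and let $l$ be the order of its subgroup of elements of order at most $2$. Then: (1) $Z_1(G)=n-1$; (2) $Z_2(G)=(n+l)/2$; (3) $Z_{n-1}(G)=n-1$; (4) $Z_n(G)=n$ if $l=2$, and $Z_n(G)=n-1$ if $l\neq 2$.
   Context: $G$ is written additively. For $A\subseteq G$ and a positive integer $h$, $h\hat{\;}A$ denotes the set of all sums of $h$ pairwise distinct elements of $A$. $Z_h(G)=\max\{|A| : A\subseteq G,\ 0\notin h\hat{\;}A\}$. -}

module Defs where

open import Data.Nat using (ℕ; zero; suc; _≤_)
open import Data.Fin using (Fin; zero; suc; _≟_)
open import Data.Fin.Subset using (Subset; _∈_; ∣_∣)
open import Data.Vec using (tabulate)
open import Data.Product using (Σ; _×_)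
open import Relation.Nullary using (¬_; does)
open import Relation.Binary.PropositionalEquality using (_≡_)
open import Function.Definitions using (Injective)

-- A finite abelian group of order n is represented (up to isomorphism)
-- by an abelian group structure on Fin n, with operation _+_ and zero 0#.
module _ {n : ℕ} (_+_ : Fin n → Fin n → Fin n) (0# : Fin n) where

  sumOf : (h : ℕ) → (Fin h → Fin n) → Fin n
  sumOf zero    f = 0#
  sumOf (suc h) f = f zero + sumOf h (λ i → f (suc i))

  ZeroNotInRestrictedSumset : ℕ → Subset n → Set
  ZeroNotInRestrictedSumset h A =
    (f : Fin h → Fin n) → Injective _≡_ _≡_ f → (∀ i → f i ∈ A) → ¬ (sumOf h f ≡ 0#)

  Zh≡ : ℕ → ℕ → Set
  Zh≡ h m =
    (Σ (Subset n) λ A → ZeroNotInRestrictedSumset h A × ∣ A ∣ ≡ m)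
    × (∀ A → ZeroNotInRestrictedSumset h A → ∣ A ∣ ≤ m)

  ord≤2 : ℕ
  ord≤2 = ∣ tabulate (λ x → does ((x + x) ≟ 0#)) ∣

-- Negation is an involution of G whose fixed points are the l elements of order ≤ 2; the
-- other elements fall into (n − l)/2 pairs {x, −x}. A set with no two distinct elements
-- summing to 0 meets each pair at most once, so Z₂ = l + (n − l)/2, attained by the fixed
-- points together with one element from each pair.
-- For h ∈ {n − 1, n} only G and the sets G∖{x} have size ≥ h, and everything hinges on the
-- sum σ of all elements, since G∖{x} sums to σ − x.
-- The pairs {x, −x} cancel, so σ is the sum of the subgroup T of elements of order ≤ 2;
-- translation by any t ≠ 0 in T splits T into pairs {x, x + t}, so σ = (|T|/2)·t for every
-- such t. Hence σ = t ≠ 0 if |T| = 2, σ = 0 if |T|/2 is even, and |T|/2 odd with |T| > 2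
-- is impossible, since then all nonzero elements of T would equal σ.

module Submission where

open import Defs
open import Algebra.Bundles using (AbelianGroup)
open import Algebra.Core using (Op₁; Op₂)
open import Algebra.Structures using (IsAbelianGroup)
import Algebra.Properties.AbelianGroup as AbelianGroupProperties
import Algebra.Properties.CommutativeMonoid.Sum as CommutativeMonoidSum
import Algebra.Properties.Group as GroupProperties
import Algebra.Properties.Monoid.Mult as MonoidMult
open import Data.Bool using (Bool; true; false; T; not; _∧_; _∨_)
open import Data.Bool.Properties using (T-≡)
open import Data.Fin using (Fin; zero; suc; punchIn; punchOut; _<?_)
import Data.Fin.Properties as Fin
open import Data.Fin.Subset using (Subset; ∣_∣; ⁅_⁆; ∁; ⊤) renaming (_∈_ to _∈ₛ_; _∉_ to _∉ₛ_)
open import Data.Fin.Subset.Properties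
  using (∣p∣≤n; ∣⊤∣≡n; ∣∁p∣≡n∸∣p∣; ∣⁅x⁆∣≡1; ∣p∣≡n⇒p≡⊤; p⊆q⇒∣p∣≤∣q∣; ∈⊤; x∈⁅x⁆; x∈⁅y⁆⇒x≡y;
         x∈∁p⇒x∉p; x∉p⇒x∈∁p)
open import Data.List as List using (List; []; _∷_; _++_; [_]; length; foldr; filterᵇ; allFin)
open import Data.List.Membership.Propositional using (_∈_; _∉_; find)
open import Data.List.Membership.Propositional.Properties using (∈-∃++; ∈-filter⁻; ∈-filter⁺; ∈-allFin)
open import Data.List.Properties
  using (filter-++; filter-all; filter-none; length-filter; length-++; length-tabulate; ++-identityʳ)
open import Data.List.Relation.Unary.Any using (here; there)
open import Data.List.Relation.Unary.All as All using (All; []; _∷_)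
open import Data.List.Relation.Unary.All.Properties using (All¬⇒¬Any; ¬All⇒Any¬)
open import Data.List.Relation.Unary.AllPairs as AllPairs using ([]; _∷_)
open import Data.List.Relation.Unary.Unique.Propositional using (Unique)
open import Data.List.Relation.Unary.Unique.Propositional.Properties using (filter⁺; allFin⁺)
open import Data.List.Relation.Binary.Permutation.Propositional
  using (_↭_; prep; ↭-refl; ↭-sym; ↭-trans; ↭⇒↭ₛ)
open import Data.List.Relation.Binary.Permutation.Propositional.Properties
  using (∈-resp-↭; ↭-length; shift; shifts; filter-↭)
import Data.List.Relation.Binary.Permutation.Setoid.Properties as Perm
open import Data.Nat using (ℕ; zero; suc; _+_; _*_; _∸_; _≤_; z≤n; s≤s; s≤s⁻¹; ⌊_/2⌋; parity)
open import Data.Nat.DivMod using (_/_; m*n/n≡m; /-monoˡ-≤)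
import Data.Nat.Properties as ℕ
open import Data.Nat.Tactic.RingSolver using (solve-∀)
open import Data.Parity using (0ℙ; 1ℙ)
open import Data.Product using (_×_; _,_; proj₂; ∃-syntax)
open import Data.Sum using (_⊎_; inj₁; inj₂)
open import Data.Vec using (tabulate; lookup)
open import Data.Vec.Properties using (lookup∘tabulate; tabulate∘lookup; []=⇒lookup; lookup⇒[]=)
open import Data.Vec.Functional using (removeAt) renaming (_∷_ to _∷ᵛ_)
open import Function using (_∘_; id)
open import Function.Bundles using (Equivalence)
open import Function.Definitions using (Injective)
open import Relation.Binary.Definitions using (DecidableEquality; tri<; tri≈; tri>)
open import Relation.Binary.PropositionalEquality
  using (_≡_; _≢_; refl; sym; trans; cong; cong₂; subst; subst₂; setoid; module ≡-Reasoning)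
open import Relation.Nullary using (¬_; yes; no; does; contradiction)
open import Relation.Nullary.Decidable using (T?; dec-true; dec-false)

Unique∧⊆⇒length≤ : ∀ {A : Set} {xs ys : List A} → Unique xs → (∀ {x} → x ∈ xs → x ∈ ys) →
                   length xs ≤ length ys
Unique∧⊆⇒length≤ []          _     = z≤n
Unique∧⊆⇒length≤ {xs = x ∷ xs} (x≢xs ∷ u) xs⊆ys with ∈-∃++ (xs⊆ys (here refl))
... | ys₁ , ys₂ , refl = subst (_ ≤_) (sym (↭-length (shift x ys₁ ys₂)))
                               (s≤s (Unique∧⊆⇒length≤ u xs⊆ys₁++ys₂))
  where
    xs⊆ys₁++ys₂ : ∀ {y} → y ∈ xs → y ∈ ys₁ ++ ys₂
    xs⊆ys₁++ys₂ y∈xs with ∈-resp-↭ (shift x ys₁ ys₂) (xs⊆ys (there y∈xs))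
    ... | here y≡x = contradiction (sym y≡x) (All.lookup x≢xs y∈xs)
    ... | there y∈ys₁++ys₂ = y∈ys₁++ys₂

Unique⇒∃≢ : ∀ {A : Set} → DecidableEquality A → (c : A) {xs : List A} →
            Unique xs → 2 ≤ length xs → ∃[ x ] x ∈ xs × x ≢ c
Unique⇒∃≢ _≟_ c {x ∷ y ∷ _} ((x≢y ∷ _) ∷ _) (s≤s (s≤s z≤n)) with x ≟ c
... | no  x≢c = x , here refl , x≢c
... | yes x≡c = y , there (here refl) , λ y≡c → x≢y (trans x≡c (sym y≡c))

filterᵇ-all : ∀ {A : Set} (b : A → Bool) {xs} → All (λ x → b x ≡ true) xs → filterᵇ b xs ≡ xs
filterᵇ-all b = filter-all (T? ∘ b) ∘ All.map (Equivalence.from T-≡)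

filterᵇ-none : ∀ {A : Set} (b : A → Bool) {xs} → All (λ x → b x ≡ false) xs → filterᵇ b xs ≡ []
filterᵇ-none b = filter-none (T? ∘ b) ∘ All.map (λ b≡false → subst T b≡false)

⌊n/2⌋≡0 : ∀ {n} → n ≤ 1 → ⌊ n /2⌋ ≡ 0
⌊n/2⌋≡0 z≤n       = refl
⌊n/2⌋≡0 (s≤s z≤n) = refl

-- Orbits of an involution

module InvolutionOrbits {A : Set} (_≟_ : DecidableEquality A)
                        (φ : A → A) (φ-involutive : ∀ x → φ (φ x) ≡ x) where

  private variable
    x : A
    xs ws : List A

  orbits : List A → List A
  orbits []       = []
  orbits (x ∷ xs) = x ∷ φ x ∷ orbits xs

  length-orbits : ∀ xs → length (orbits xs) ≡ length xs + length xs
  length-orbits []       = refl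
  length-orbits (x ∷ xs) = cong suc (begin
    suc (length (orbits xs))          ≡⟨ cong suc (length-orbits xs) ⟩
    suc (length xs + length xs)       ≡⟨ ℕ.+-suc (length xs) (length xs) ⟨
    length xs + suc (length xs)       ∎)
    where open ≡-Reasoning

  ∈-orbits⁺ : x ∈ xs → x ∈ orbits xs
  ∈-orbits⁺ (here x≡y)  = here x≡y
  ∈-orbits⁺ (there x∈xs) = there (there (∈-orbits⁺ x∈xs))

  length-filter-orbits-≤ : ∀ (b : A → Bool) {P} → All (λ p → b p ∧ b (φ p) ≡ false) P →
                           length (filterᵇ b (orbits P)) ≤ length P
  length-filter-orbits-≤ b [] = z≤n
  length-filter-orbits-≤ b {p ∷ P} (both≡false ∷ rest) with b p | both≡false
  ... | true  | φp≡false rewrite φp≡false = s≤s (length-filter-orbits-≤ b rest)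
  ... | false | _ with b (φ p)
  ...   | true  = s≤s (length-filter-orbits-≤ b rest)
  ...   | false = ℕ.m≤n⇒m≤1+n (length-filter-orbits-≤ b rest)

  length-filter-orbits-≡ : ∀ (b : A → Bool) {P} → All (λ p → b (φ p) ≡ not (b p)) P →
                           length (filterᵇ b (orbits P)) ≡ length P
  length-filter-orbits-≡ b [] = refl
  length-filter-orbits-≡ b {p ∷ P} (exactlyOne ∷ rest) with b p | exactlyOne
  ... | true  | φp≡false rewrite φp≡false = cong suc (length-filter-orbits-≡ b rest)
  ... | false | φp≡true  rewrite φp≡true  = cong suc (length-filter-orbits-≡ b rest)

  Fixed : A → Set
  Fixed x = φ x ≡ x

  Closed : List A → Set
  Closed xs = ∀ {x} → x ∈ xs → φ x ∈ xs

  ¬Fixed-φ : ¬ Fixed x → ¬ Fixed (φ x)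
  ¬Fixed-φ {x} ¬fx φφx≡φx = ¬fx (sym (trans (sym (φ-involutive x)) φφx≡φx))

  orbits-¬Fixed : All (¬_ ∘ Fixed) xs → All (¬_ ∘ Fixed) (orbits xs)
  orbits-¬Fixed []            = []
  orbits-¬Fixed (¬fx ∷ ¬fxs) = ¬fx ∷ ¬Fixed-φ ¬fx ∷ orbits-¬Fixed ¬fxs

  record Decomposition (xs : List A) : Set where
    constructor decomposition
    field
      fixedPoints     : List A
      representatives : List A
      ↭-split         : xs ↭ fixedPoints ++ orbits representatives
      all-fixed       : All Fixed fixedPoints
      none-fixed      : All (¬_ ∘ Fixed) representatives

  private
    φ-injective : ∀ {x y} → φ x ≡ φ y → x ≡ y
    φ-injective {x} {y} eq = trans (sym (φ-involutive x)) (trans (cong φ eq) (φ-involutive y))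

    Unique-resp-↭ : ∀ {xs ys : List A} → xs ↭ ys → Unique xs → Unique ys
    Unique-resp-↭ p = Perm.Unique-resp-↭ (setoid A) (↭⇒↭ₛ p)

    Closed-resp-↭ : ∀ {xs ys : List A} → xs ↭ ys → Closed xs → Closed ys
    Closed-resp-↭ p c y∈ys = ∈-resp-↭ p (c (∈-resp-↭ (↭-sym p) y∈ys))

    head∉tail : Unique (x ∷ xs) → x ∉ xs
    head∉tail = All¬⇒¬Any ∘ AllPairs.head

    Closed-dropFixed : Fixed x → Unique (x ∷ xs) → Closed (x ∷ xs) → Closed xs
    Closed-dropFixed fx u c {y} y∈xs with c (there y∈xs)
    ... | here φy≡x   = contradiction (subst (_∈ _) (φ-injective (trans φy≡x (sym fx))) y∈xs)
                                      (head∉tail u)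
    ... | there φy∈xs = φy∈xs

    Closed-dropOrbit : Unique (x ∷ φ x ∷ xs) → Closed (x ∷ φ x ∷ xs) → Closed xs
    Closed-dropOrbit {x = x} u@(_ ∷ u′) c {y} y∈xs with c (there (there y∈xs))
    ... | here φy≡x = contradiction (subst (_∈ _) (trans (sym (φ-involutive y)) (cong φ φy≡x)) y∈xs)
                                    (head∉tail u′)
    ... | there (here φy≡φx) = contradiction (subst (_∈ φ x ∷ _) (φ-injective φy≡φx) (there y∈xs))
                                             (head∉tail u)
    ... | there (there φy∈xs) = φy∈xs

    consFixed : Fixed x → Decomposition xs → Decomposition (x ∷ xs)
    consFixed {x = x} fx (decomposition F P split allF noneP) =
      decomposition (x ∷ F) P (prep x split) (fx ∷ allF) noneP

    consOrbit : ¬ Fixed x → xs ↭ x ∷ φ x ∷ ws → Decomposition ws → Decomposition xs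
    consOrbit {x = x} ¬fx p (decomposition F P split allF noneP) =
      decomposition F (x ∷ P)
                    (↭-trans p (↭-trans (prep x (prep (φ x) split)) (shifts (x ∷ φ x ∷ []) F)))
                    allF (¬fx ∷ noneP)

    decompose′ : ∀ k xs → length xs ≤ k → Unique xs → Closed xs → Decomposition xs
    decompose′ _       []       _            _ _ = decomposition [] [] ↭-refl [] []
    decompose′ (suc k) (x ∷ xs) (s≤s |xs|≤k) u c with φ x ≟ x
    ... | yes fx = consFixed fx (decompose′ k xs |xs|≤k (AllPairs.tail u) (Closed-dropFixed fx u c))
    ... | no ¬fx with c (here refl)
    ...   | here φx≡x   = contradiction φx≡x ¬fx
    ...   | there φx∈xs with ∈-∃++ φx∈xs
    ...     | ys , zs , refl = consOrbit ¬fx pair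
                (decompose′ k (ys ++ zs) |ys++zs|≤k (AllPairs.tail (AllPairs.tail u′))
                            (Closed-dropOrbit u′ (Closed-resp-↭ pair c)))
      where
        pair : x ∷ ys ++ [ φ x ] ++ zs ↭ x ∷ φ x ∷ ys ++ zs
        pair = prep x (shift (φ x) ys zs)
        u′ : Unique (x ∷ φ x ∷ ys ++ zs)
        u′ = Unique-resp-↭ pair u
        |ys++zs|≤k : length (ys ++ zs) ≤ k
        |ys++zs|≤k = ℕ.≤-trans (ℕ.n≤1+n _) (subst (_≤ k) (↭-length (shift (φ x) ys zs)) |xs|≤k)

  decompose : Unique xs → Closed xs → Decomposition xs
  decompose {xs} = decompose′ (length xs) xs ℕ.≤-refl

-- Sums over a finite abelian group

module AbelianGroupSums {G : Set} (_≟_ : DecidableEquality G)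
                        {_⊕_ : Op₂ G} {0# : G} {⊖_ : Op₁ G}
                        (isAbelianGroup : IsAbelianGroup _≡_ _⊕_ 0# ⊖_) where

  abelianGroup : AbelianGroup _ _
  abelianGroup = record { isAbelianGroup = isAbelianGroup }

  open AbelianGroup abelianGroup
    using (assoc; identityˡ; identityʳ; inverseʳ; isCommutativeMonoid; commutativeMonoid; group; monoid)
  open GroupProperties group using (identityʳ-unique; inverseʳ-unique; ⁻¹-involutive)
  open AbelianGroupProperties abelianGroup using (⁻¹-∙-comm)
  open MonoidMult monoid using () renaming (_×_ to _·_)
  open CommutativeMonoidSum commutativeMonoid using (sum; sum-remove; sum-cong-≗)
  open ≡-Reasoning

  ∑ : List G → G
  ∑ = foldr _⊕_ 0#

  ∑-++ : ∀ xs ys → ∑ (xs ++ ys) ≡ ∑ xs ⊕ ∑ ys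
  ∑-++ []       ys = sym (identityˡ (∑ ys))
  ∑-++ (x ∷ xs) ys = trans (cong (x ⊕_) (∑-++ xs ys)) (sym (assoc x (∑ xs) (∑ ys)))

  ∑-↭ : ∀ {xs ys} → xs ↭ ys → ∑ xs ≡ ∑ ys
  ∑-↭ p = Perm.foldr-commMonoid (setoid G) isCommutativeMonoid (↭⇒↭ₛ p)

  sum-∘-injective : ∀ {m} (σ : Fin m → Fin m) → Injective _≡_ _≡_ σ → (g : Fin m → G) →
                    sum (g ∘ σ) ≡ sum g
  sum-∘-injective {zero}  σ σ-inj g = refl
  sum-∘-injective {suc m} σ σ-inj g = begin
    g (σ zero) ⊕ sum (g ∘ σ ∘ suc)                  ≡⟨ cong (g (σ zero) ⊕_) (sum-cong-≗ g∘σ∘suc≗g′∘σ′) ⟩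
    g (σ zero) ⊕ sum (removeAt g (σ zero) ∘ σ′)     ≡⟨ cong (g (σ zero) ⊕_) (sum-∘-injective σ′ σ′-inj _) ⟩
    g (σ zero) ⊕ sum (removeAt g (σ zero))          ≡⟨ sum-remove g ⟨
    sum g                                           ∎
    where
      σ0≢σsuc : ∀ j → σ zero ≢ σ (suc j)
      σ0≢σsuc j eq with () ← σ-inj eq
      σ′ : Fin m → Fin m
      σ′ j = punchOut (σ0≢σsuc j)
      σ′-inj : Injective _≡_ _≡_ σ′
      σ′-inj {i} {j} eq = Fin.suc-injective (σ-inj (Fin.punchOut-injective (σ0≢σsuc i) (σ0≢σsuc j) eq))
      g∘σ∘suc≗g′∘σ′ : ∀ j → g (σ (suc j)) ≡ g (punchIn (σ zero) (σ′ j))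
      g∘σ∘suc≗g′∘σ′ j = cong g (sym (Fin.punchIn-punchOut (σ0≢σsuc j)))

  Order≤2 : G → Set
  Order≤2 x = x ⊕ x ≡ 0#

  ⊖-fixed⇒order≤2 : ∀ {x} → ⊖ x ≡ x → Order≤2 x
  ⊖-fixed⇒order≤2 {x} ⊖x≡x = trans (cong (x ⊕_) (sym ⊖x≡x)) (inverseʳ x)

  order≤2⇒⊖-fixed : ∀ {x} → Order≤2 x → ⊖ x ≡ x
  order≤2⇒⊖-fixed {x} x⊕x≡0 = sym (inverseʳ-unique x x x⊕x≡0)

  order≤2-⊕ : ∀ {x y} → Order≤2 x → Order≤2 y → Order≤2 (x ⊕ y)
  order≤2-⊕ {x} {y} x² y² = ⊖-fixed⇒order≤2 (begin
    ⊖ (x ⊕ y)     ≡⟨ ⁻¹-∙-comm x y ⟨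
    (⊖ x) ⊕ (⊖ y) ≡⟨ cong₂ _⊕_ (order≤2⇒⊖-fixed x²) (order≤2⇒⊖-fixed y²) ⟩
    x ⊕ y         ∎)

  order≤2? : G → Bool
  order≤2? x = does ((x ⊕ x) ≟ 0#)

  order≤2?-sound : ∀ {x} → T (order≤2? x) → Order≤2 x
  order≤2?-sound {x} with (x ⊕ x) ≟ 0#
  ... | yes x² = λ _ → x²

  order≤2?-complete : ∀ {x} → Order≤2 x → T (order≤2? x)
  order≤2?-complete {x} x² with (x ⊕ x) ≟ 0#
  ... | yes _   = _
  ... | no  ¬x² = ¬x² x²

  order≤2?-fixed : ∀ {x} → ⊖ x ≡ x → order≤2? x ≡ true
  order≤2?-fixed {x} = dec-true ((x ⊕ x) ≟ 0#) ∘ ⊖-fixed⇒order≤2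

  order≤2?-moved : ∀ {x} → ⊖ x ≢ x → order≤2? x ≡ false
  order≤2?-moved {x} ⊖x≢x = dec-false ((x ⊕ x) ≟ 0#) (⊖x≢x ∘ order≤2⇒⊖-fixed)

  module Negation = InvolutionOrbits _≟_ ⊖_ ⁻¹-involutive

  ∑-negationOrbits : ∀ P → ∑ (Negation.orbits P) ≡ 0#
  ∑-negationOrbits []      = refl
  ∑-negationOrbits (p ∷ P) = begin
    p ⊕ ((⊖ p) ⊕ ∑ (Negation.orbits P)) ≡⟨ assoc p (⊖ p) _ ⟨
    (p ⊕ (⊖ p)) ⊕ ∑ (Negation.orbits P) ≡⟨ cong₂ _⊕_ (inverseʳ p) (∑-negationOrbits P) ⟩
    0# ⊕ 0#                             ≡⟨ identityʳ 0# ⟩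
    0#                                  ∎

  module Translation {t} (t² : Order≤2 t) = InvolutionOrbits _≟_ (_⊕ t) (λ x → begin
    (x ⊕ t) ⊕ t   ≡⟨ assoc x t t ⟩
    x ⊕ (t ⊕ t)   ≡⟨ cong (x ⊕_) t² ⟩
    x ⊕ 0#        ≡⟨ identityʳ x ⟩
    x             ∎)

  ∑-translationOrbits : ∀ {t} (t² : Order≤2 t) {P} → All Order≤2 P →
                        ∑ (Translation.orbits t² P) ≡ length P · t
  ∑-translationOrbits t² []             = refl
  ∑-translationOrbits {t} t² {p ∷ P} (p² ∷ P²) = begin
    p ⊕ ((p ⊕ t) ⊕ ∑ (Translation.orbits t² P))   ≡⟨ assoc p (p ⊕ t) _ ⟨
    (p ⊕ (p ⊕ t)) ⊕ ∑ (Translation.orbits t² P)   ≡⟨ cong₂ _⊕_ p⊕[p⊕t]≡t (∑-translationOrbits t² P²) ⟩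
    t ⊕ (length P · t)                            ∎
    where
      p⊕[p⊕t]≡t : p ⊕ (p ⊕ t) ≡ t
      p⊕[p⊕t]≡t = trans (sym (assoc p p t)) (trans (cong (_⊕ t) p²) (identityˡ t))

  [2+j]·t≡j·t : ∀ {t} → Order≤2 t → ∀ j → (2 + j) · t ≡ j · t
  [2+j]·t≡j·t {t} t² j = begin
    t ⊕ (t ⊕ (j · t)) ≡⟨ assoc t t (j · t) ⟨
    (t ⊕ t) ⊕ (j · t) ≡⟨ cong (_⊕ (j · t)) t² ⟩
    0# ⊕ (j · t)      ≡⟨ identityˡ (j · t) ⟩
    j · t             ∎

  ·-even : ∀ {t} → Order≤2 t → ∀ j → parity j ≡ 0ℙ → j · t ≡ 0#
  ·-odd  : ∀ {t} → Order≤2 t → ∀ j → parity j ≡ 1ℙ → j · t ≡ t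
  ·-even t² zero          _  = refl
  ·-even t² (suc (suc j)) pj = trans ([2+j]·t≡j·t t² j) (·-even t² j pj)
  ·-odd  t² (suc zero)    _  = identityʳ _
  ·-odd  t² (suc (suc j)) pj = trans ([2+j]·t≡j·t t² j) (·-odd t² j pj)

  ∑-zeros : ∀ {xs} → All (_≡ 0#) xs → ∑ xs ≡ 0#
  ∑-zeros []             = refl
  ∑-zeros (x≡0 ∷ xs≡0) = trans (cong₂ _⊕_ x≡0 (∑-zeros xs≡0)) (identityʳ 0#)

  module ElementaryTwoGroup {T : List G} (T-unique : Unique T)
                            (T-order≤2 : ∀ {x} → x ∈ T → Order≤2 x)
                            (T-closed : ∀ {x y} → x ∈ T → y ∈ T → x ⊕ y ∈ T) where

    ∑≡⌊|T|/2⌋·t : ∀ {t} → t ∈ T → t ≢ 0# → ∑ T ≡ ⌊ length T /2⌋ · t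
    ∑≡⌊|T|/2⌋·t {t} t∈T t≢0
      with Translation.decompose (T-order≤2 t∈T) T-unique (λ x∈T → T-closed x∈T t∈T)
    ... | Translation.decomposition (x ∷ _) _ _ (x⊕t≡x ∷ _) _ =
      contradiction (identityʳ-unique x t x⊕t≡x) t≢0
    ... | Translation.decomposition [] P split _ _ = begin
      ∑ T                                      ≡⟨ ∑-↭ split ⟩
      ∑ (Translation.orbits t² P)              ≡⟨ ∑-translationOrbits t² P-order≤2 ⟩
      length P · t                             ≡⟨ cong (_· t) (ℕ.n≡⌊n+n/2⌋ (length P)) ⟩
      ⌊ length P + length P /2⌋ · t            ≡⟨ cong (λ m → ⌊ m /2⌋ · t) |T|≡|P|+|P| ⟨
      ⌊ length T /2⌋ · t                       ∎
      where
        t² = T-order≤2 t∈T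
        P-order≤2 : All Order≤2 P
        P-order≤2 = All.tabulate λ p∈P →
          T-order≤2 (∈-resp-↭ (↭-sym split) (Translation.∈-orbits⁺ t² p∈P))
        |T|≡|P|+|P| : length T ≡ length P + length P
        |T|≡|P|+|P| = trans (↭-length split) (Translation.length-orbits t² P)

    ∑≢0# : length T ≡ 2 → ∑ T ≢ 0#
    ∑≢0# |T|≡2 ∑≡0 with t , t∈T , t≢0 ← Unique⇒∃≢ _≟_ 0# T-unique (ℕ.≤-reflexive (sym |T|≡2)) =
      t≢0 (begin
        t                    ≡⟨ identityʳ t ⟨
        1 · t                ≡⟨ cong (λ m → ⌊ m /2⌋ · t) |T|≡2 ⟨
        ⌊ length T /2⌋ · t   ≡⟨ ∑≡⌊|T|/2⌋·t t∈T t≢0 ⟨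
        ∑ T                  ≡⟨ ∑≡0 ⟩
        0#                   ∎)

    ∑≡0# : length T ≢ 2 → ∑ T ≡ 0#
    ∑≡0# |T|≢2 with All.all? (_≟ 0#) T
    ... | yes T≡0 = ∑-zeros T≡0
    ... | no  T≢0 with find (¬All⇒Any¬ (_≟ 0#) T T≢0)
    ...   | t , t∈T , t≢0 with parity ⌊ length T /2⌋ in parity≡
    ...     | 0ℙ = trans (∑≡⌊|T|/2⌋·t t∈T t≢0) (·-even (T-order≤2 t∈T) ⌊ length T /2⌋ parity≡)
    ...     | 1ℙ = contradiction (trans (sym parity≡) (cong parity (⌊n/2⌋≡0 |T|≤1))) λ ()
      where
        T⊆0,∑T : ∀ {u} → u ∈ T → u ∈ 0# ∷ ∑ T ∷ []
        T⊆0,∑T {u} u∈T with u ≟ 0#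
        ... | yes u≡0 = here u≡0
        ... | no  u≢0 = there (here (trans (sym (·-odd (T-order≤2 u∈T) ⌊ length T /2⌋ parity≡))
                                           (sym (∑≡⌊|T|/2⌋·t u∈T u≢0))))
        |T|≤1 : length T ≤ 1
        |T|≤1 = s≤s⁻¹ (ℕ.≤∧≢⇒< (Unique∧⊆⇒length≤ T-unique T⊆0,∑T) |T|≢2)

  module Enumeration {E : List G} (E-unique : Unique E) (E-complete : ∀ x → x ∈ E) where

    elementsOfOrder≤2 : List G
    elementsOfOrder≤2 = filterᵇ order≤2? E

    private
      open Negation.Decomposition (Negation.decompose E-unique (λ _ → E-complete _))
        renaming (fixedPoints to F; representatives to P; ↭-split to E↭F++orbitsP)

      orbitsP = Negation.orbits P

      filterᵇ-split : ∀ b → filterᵇ b E ↭ filterᵇ b F ++ filterᵇ b orbitsP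
      filterᵇ-split b =
        subst (filterᵇ b E ↭_) (filter-++ (T? ∘ b) F orbitsP) (filter-↭ (T? ∘ b) E↭F++orbitsP)

      length-filterᵇ-split : ∀ b → length (filterᵇ b E) ≡ length (filterᵇ b F) + length (filterᵇ b orbitsP)
      length-filterᵇ-split b = trans (↭-length (filterᵇ-split b)) (length-++ (filterᵇ b F))

      elementsOfOrder≤2↭F : elementsOfOrder≤2 ↭ F
      elementsOfOrder≤2↭F = subst (elementsOfOrder≤2 ↭_) F++[]≡F (filterᵇ-split order≤2?)
        where
          F++[]≡F : filterᵇ order≤2? F ++ filterᵇ order≤2? orbitsP ≡ F
          orbitsP-moved = Negation.orbits-¬Fixed none-fixed
          F++[]≡F = trans (cong₂ _++_ (filterᵇ-all order≤2? (All.map order≤2?-fixed all-fixed))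
                                      (filterᵇ-none order≤2? (All.map order≤2?-moved orbitsP-moved)))
                          (++-identityʳ F)

    ∑E≡∑elementsOfOrder≤2 : ∑ E ≡ ∑ elementsOfOrder≤2
    ∑E≡∑elementsOfOrder≤2 = begin
      ∑ E                    ≡⟨ ∑-↭ E↭F++orbitsP ⟩
      ∑ (F ++ orbitsP)       ≡⟨ ∑-++ F orbitsP ⟩
      ∑ F ⊕ ∑ orbitsP        ≡⟨ cong (∑ F ⊕_) (∑-negationOrbits P) ⟩
      ∑ F ⊕ 0#               ≡⟨ identityʳ (∑ F) ⟩
      ∑ F                    ≡⟨ ∑-↭ elementsOfOrder≤2↭F ⟨
      ∑ elementsOfOrder≤2    ∎

    private
      ∈elementsOfOrder≤2⇒order≤2 : ∀ {x} → x ∈ elementsOfOrder≤2 → Order≤2 x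
      ∈elementsOfOrder≤2⇒order≤2 = order≤2?-sound ∘ proj₂ ∘ ∈-filter⁻ (T? ∘ order≤2?) {xs = E}

      elementsOfOrder≤2-closed : ∀ {x y} → x ∈ elementsOfOrder≤2 → y ∈ elementsOfOrder≤2 →
                                 x ⊕ y ∈ elementsOfOrder≤2
      elementsOfOrder≤2-closed x∈ y∈ = ∈-filter⁺ (T? ∘ order≤2?) (E-complete _)
        (order≤2?-complete (order≤2-⊕ (∈elementsOfOrder≤2⇒order≤2 x∈) (∈elementsOfOrder≤2⇒order≤2 y∈)))

      module OrderTwoSubgroup = ElementaryTwoGroup (filter⁺ (T? ∘ order≤2?) E-unique)
                                  ∈elementsOfOrder≤2⇒order≤2 elementsOfOrder≤2-closed

    ∑E≡0# : length elementsOfOrder≤2 ≢ 2 → ∑ E ≡ 0#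
    ∑E≡0# |T|≢2 = trans ∑E≡∑elementsOfOrder≤2 (OrderTwoSubgroup.∑≡0# |T|≢2)

    ∑E≢0# : length elementsOfOrder≤2 ≡ 2 → ∑ E ≢ 0#
    ∑E≢0# |T|≡2 = OrderTwoSubgroup.∑≢0# |T|≡2 ∘ trans (sym ∑E≡∑elementsOfOrder≤2)

    private
      |E|+|T|≡[|F|+|P|]*2 : length E + length elementsOfOrder≤2 ≡ (length F + length P) * 2
      |E|+|T|≡[|F|+|P|]*2 = begin
        length E + length elementsOfOrder≤2               ≡⟨ cong₂ _+_ |E| (↭-length elementsOfOrder≤2↭F) ⟩
        (length F + (length P + length P)) + length F     ≡⟨ arith (length F) (length P) ⟩
        (length F + length P) * 2                         ∎
        where
          |E| : length E ≡ length F + (length P + length P)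
          |E| = trans (↭-length E↭F++orbitsP)
                      (trans (length-++ F) (cong (length F +_) (Negation.length-orbits P)))
          arith : ∀ f p → (f + (p + p)) + f ≡ (f + p) * 2
          arith = solve-∀

    length-filterᵇ-≤ : ∀ b → (∀ x → ⊖ x ≢ x → b x ∧ b (⊖ x) ≡ false) →
                       length (filterᵇ b E) * 2 ≤ length E + length elementsOfOrder≤2
    length-filterᵇ-≤ b no-pair =
      subst₂ _≤_ (cong (_* 2) (sym (length-filterᵇ-split b))) (sym |E|+|T|≡[|F|+|P|]*2)
        (ℕ.*-monoˡ-≤ 2 (ℕ.+-mono-≤ (length-filter (T? ∘ b) F)
                                   (Negation.length-filter-orbits-≤ b (All.map (no-pair _) none-fixed))))

    length-filterᵇ-≡ : ∀ b → (∀ x → ⊖ x ≡ x → b x ≡ true) → (∀ x → ⊖ x ≢ x → b (⊖ x) ≡ not (b x)) →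
                       length (filterᵇ b E) * 2 ≡ length E + length elementsOfOrder≤2
    length-filterᵇ-≡ b fixed-in one-of-pair = begin
      length (filterᵇ b E) * 2                                 ≡⟨ cong (_* 2) (length-filterᵇ-split b) ⟩
      (length (filterᵇ b F) + length (filterᵇ b orbitsP)) * 2  ≡⟨ cong (_* 2) (cong₂ _+_ |filter-F| |filter-orbitsP|) ⟩
      (length F + length P) * 2                                ≡⟨ |E|+|T|≡[|F|+|P|]*2 ⟨
      length E + length elementsOfOrder≤2                      ∎
      where
        |filter-F| = cong length (filterᵇ-all b (All.map (fixed-in _) all-fixed))
        |filter-orbitsP| = Negation.length-filter-orbits-≡ b (All.map (one-of-pair _) none-fixed)

-- Restricted sumsets

∣tabulate∣≡length-filterᵇ : ∀ {A : Set} {n} (f : Fin n → A) (b : A → Bool) →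
                           ∣ tabulate (b ∘ f) ∣ ≡ length (filterᵇ b (List.tabulate f))
∣tabulate∣≡length-filterᵇ {n = zero}  f b = refl
∣tabulate∣≡length-filterᵇ {n = suc n} f b with b (f zero)
... | true  = cong suc (∣tabulate∣≡length-filterᵇ (f ∘ suc) b)
... | false = ∣tabulate∣≡length-filterᵇ (f ∘ suc) b

∣p∣≡length-filterᵇ : ∀ {n} (p : Subset n) → ∣ p ∣ ≡ length (filterᵇ (lookup p) (allFin n))
∣p∣≡length-filterᵇ p = trans (cong ∣_∣ (sym (tabulate∘lookup p))) (∣tabulate∣≡length-filterᵇ id (lookup p))

∈-tabulate⁻ : ∀ {n} (b : Fin n → Bool) {x} → x ∈ₛ tabulate b → b x ≡ true
∈-tabulate⁻ b {x} x∈ = trans (sym (lookup∘tabulate b x)) ([]=⇒lookup x∈)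

∈∁⁅x⁆⇒≢ : ∀ {n} {x y : Fin n} → y ∈ₛ ∁ ⁅ x ⁆ → y ≢ x
∈∁⁅x⁆⇒≢ {x = x} y∈ refl = x∈∁p⇒x∉p y∈ (x∈⁅x⁆ x)

∣∁⁅x⁆∣≡n∸1 : ∀ {n} (x : Fin n) → ∣ ∁ ⁅ x ⁆ ∣ ≡ n ∸ 1
∣∁⁅x⁆∣≡n∸1 {n} x = trans (∣∁p∣≡n∸∣p∣ ⁅ x ⁆) (cong (n ∸_) (∣⁅x⁆∣≡1 x))

x∉p⇒∣p∣≤n∸1 : ∀ {n} {x : Fin n} {p} → x ∉ₛ p → ∣ p ∣ ≤ n ∸ 1
x∉p⇒∣p∣≤n∸1 {x = x} {p} x∉p = subst (∣ p ∣ ≤_) (∣∁⁅x⁆∣≡n∸1 x) (p⊆q⇒∣p∣≤∣q∣ p⊆∁⁅x⁆)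
  where
    p⊆∁⁅x⁆ : ∀ {y} → y ∈ₛ p → y ∈ₛ ∁ ⁅ x ⁆
    p⊆∁⁅x⁆ y∈p = x∉p⇒x∈∁p (λ y∈⁅x⁆ → x∉p (subst (_∈ₛ p) (x∈⁅y⁆⇒x≡y x y∈⁅x⁆) y∈p))

p≡⊤⊎∣p∣≤n∸1 : ∀ {m} (p : Subset (suc m)) → p ≡ ⊤ ⊎ ∣ p ∣ ≤ m
p≡⊤⊎∣p∣≤n∸1 {m} p with ∣ p ∣ ℕ.≟ suc m
... | yes ∣p∣≡n = inj₁ (∣p∣≡n⇒p≡⊤ ∣p∣≡n)
... | no  ∣p∣≢n = inj₂ (s≤s⁻¹ (ℕ.≤∧≢⇒< (∣p∣≤n p) ∣p∣≢n))

∃≢ : ∀ {n} → 2 ≤ n → (y : Fin n) → ∃[ x ] x ≢ y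
∃≢ (s≤s (s≤s _)) zero    = suc zero , λ ()
∃≢ (s≤s (s≤s _)) (suc _) = zero , λ ()

does-<?-flip : ∀ {n} {x y : Fin n} → x ≢ y → does (y <? x) ≡ not (does (x <? y))
does-<?-flip {x = x} {y} x≢y with Fin.<-cmp x y
... | tri< x<y _ _  = trans (dec-false (y <? x) (Fin.<-asym x<y)) (cong not (sym (dec-true (x <? y) x<y)))
... | tri≈ _ x≡y _ = contradiction x≡y x≢y
... | tri> _ _ y<x  = trans (dec-true (y <? x) y<x) (cong not (sym (dec-false (x <? y) (Fin.<-asym y<x))))

injective⇒¬¬surjective : ∀ {m} (f : Fin (suc m) → Fin (suc m)) → Injective _≡_ _≡_ f →
                         ∀ x → ¬ (∀ i → f i ≢ x)
injective⇒¬¬surjective f f-inj x f≢x = ℕ.1+n≰n (Fin.injective⇒≤ punchOut∘f-inj)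
  where
    punchOut∘f-inj : Injective _≡_ _≡_ (λ i → punchOut (f≢x i ∘ sym))
    punchOut∘f-inj eq = f-inj (Fin.punchOut-injective (f≢x _ ∘ sym) (f≢x _ ∘ sym) eq)

∷-injective : ∀ {A : Set} {m} {x : A} {f : Fin m → A} → Injective _≡_ _≡_ f → (∀ i → f i ≢ x) →
              Injective _≡_ _≡_ (x ∷ᵛ f)
∷-injective f-inj f≢x {zero}  {zero}  _  = refl
∷-injective f-inj f≢x {zero}  {suc j} eq = contradiction (sym eq) (f≢x j)
∷-injective f-inj f≢x {suc i} {zero}  eq = contradiction eq (f≢x i)
∷-injective f-inj f≢x {suc i} {suc j} eq = cong suc (f-inj eq)

-- The group has order n = suc m, so that n ∸ 1 computes to m.
module RestrictedSumsets {m : ℕ} {_⊕_ : Op₂ (Fin (suc m))} {0# : Fin (suc m)} {⊖_ : Op₁ (Fin (suc m))}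
                         (isAbelianGroup : IsAbelianGroup _≡_ _⊕_ 0# ⊖_) where

  open AbelianGroupSums Fin._≟_ isAbelianGroup
  open Enumeration (allFin⁺ (suc m)) ∈-allFin
  open AbelianGroup abelianGroup using (identityʳ; inverseʳ; commutativeMonoid; group)
  open GroupProperties group using (identityʳ-unique; inverseʳ-unique; ⁻¹-involutive)
  open CommutativeMonoidSum commutativeMonoid using (sum; sum-remove)

  private
    G = Fin (suc m)
    n = suc m
    l = ord≤2 _⊕_ 0#

  NoZeroSum : ℕ → Subset n → Set
  NoZeroSum = ZeroNotInRestrictedSumset _⊕_ 0#

  sumOf≡∑tabulate : ∀ h (g : Fin h → G) → sumOf _⊕_ 0# h g ≡ ∑ (List.tabulate g)
  sumOf≡∑tabulate zero    g = refl
  sumOf≡∑tabulate (suc h) g = cong (g zero ⊕_) (sumOf≡∑tabulate h (g ∘ suc))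

  sumOf≡sum : ∀ h (g : Fin h → G) → sumOf _⊕_ 0# h g ≡ sum g
  sumOf≡sum zero    g = refl
  sumOf≡sum (suc h) g = cong (g zero ⊕_) (sumOf≡sum h (g ∘ suc))

  ∑G : G
  ∑G = sumOf _⊕_ 0# n id

  sumOf-injective≡∑G : (f : G → G) → Injective _≡_ _≡_ f → sumOf _⊕_ 0# n f ≡ ∑G
  sumOf-injective≡∑G f f-inj = begin
    sumOf _⊕_ 0# n f  ≡⟨ sumOf≡sum n f ⟩
    sum f             ≡⟨ sum-∘-injective f f-inj id ⟩
    sum id            ≡⟨ sumOf≡sum n id ⟨
    ∑G                ∎
    where open ≡-Reasoning

  sumOf[punchIn∑G]≡0# : sumOf _⊕_ 0# m (punchIn ∑G) ≡ 0#
  sumOf[punchIn∑G]≡0# = identityʳ-unique ∑G _ (sym (begin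
    ∑G                                    ≡⟨ sumOf≡sum n id ⟩
    sum id                                ≡⟨ sum-remove {i = ∑G} id ⟩
    ∑G ⊕ sum (punchIn ∑G)                 ≡⟨ cong (∑G ⊕_) (sumOf≡sum m (punchIn ∑G)) ⟨
    ∑G ⊕ sumOf _⊕_ 0# m (punchIn ∑G)      ∎))
    where open ≡-Reasoning

  l≡length-elementsOfOrder≤2 : l ≡ length elementsOfOrder≤2
  l≡length-elementsOfOrder≤2 = ∣tabulate∣≡length-filterᵇ id order≤2?

  ∑G≡0# : l ≢ 2 → ∑G ≡ 0#
  ∑G≡0# l≢2 = trans (sumOf≡∑tabulate n id) (∑E≡0# (l≢2 ∘ trans l≡length-elementsOfOrder≤2))

  ∑G≢0# : l ≡ 2 → ∑G ≢ 0#
  ∑G≢0# l≡2 = ∑E≢0# (trans (sym l≡length-elementsOfOrder≤2) l≡2) ∘ trans (sym (sumOf≡∑tabulate n id))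

  ¬NoZeroSum⊤⇒∣A∣≤n∸1 : ∀ {h} → ¬ NoZeroSum h ⊤ → ∀ A → NoZeroSum h A → ∣ A ∣ ≤ m
  ¬NoZeroSum⊤⇒∣A∣≤n∸1 ⊤-hasZeroSum A A-zeroFree with p≡⊤⊎∣p∣≤n∸1 A
  ... | inj₁ refl = contradiction A-zeroFree ⊤-hasZeroSum
  ... | inj₂ ∣A∣≤m = ∣A∣≤m

  Z₁≡n∸1 : Zh≡ _⊕_ 0# 1 m
  Z₁≡n∸1 = (∁ ⁅ 0# ⁆ , ∁⁅0#⁆-zeroFree , ∣∁⁅x⁆∣≡n∸1 0#) , upper
    where
      ∁⁅0#⁆-zeroFree : NoZeroSum 1 (∁ ⁅ 0# ⁆)
      ∁⁅0#⁆-zeroFree f _ f∈ f₀⊕0≡0 = ∈∁⁅x⁆⇒≢ (f∈ zero) (trans (sym (identityʳ (f zero))) f₀⊕0≡0)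
      upper : ∀ A → NoZeroSum 1 A → ∣ A ∣ ≤ m
      upper A A-zeroFree = x∉p⇒∣p∣≤n∸1 λ 0∈A →
        A-zeroFree (λ _ → 0#) (λ { {zero} {zero} _ → refl }) (λ _ → 0∈A) (identityʳ 0#)

  zeroSumPair : ∀ {x} → ⊖ x ≢ x → ∀ {A} → x ∈ₛ A → ⊖ x ∈ₛ A → ¬ NoZeroSum 2 A
  zeroSumPair {x} ⊖x≢x {A} x∈A ⊖x∈A A-zeroFree = A-zeroFree pair pair-inj pair∈A pair-sum
    where
      pair : Fin 2 → G
      pair = x ∷ᵛ (⊖ x ∷ᵛ λ ())
      pair-inj : Injective _≡_ _≡_ pair
      pair-inj = ∷-injective (∷-injective (λ { {()} }) λ ()) λ { zero → ⊖x≢x ; (suc ()) }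
      pair∈A : ∀ i → pair i ∈ₛ A
      pair∈A zero       = x∈A
      pair∈A (suc zero) = ⊖x∈A
      pair-sum : x ⊕ ((⊖ x) ⊕ 0#) ≡ 0#
      pair-sum = trans (cong (x ⊕_) (identityʳ (⊖ x))) (inverseʳ x)

  zeroSum⇒⊖ : ∀ (f : Fin 2 → G) → sumOf _⊕_ 0# 2 f ≡ 0# → f (suc zero) ≡ ⊖ (f zero)
  zeroSum⇒⊖ f sum≡0 = inverseʳ-unique (f zero) (f (suc zero))
                        (trans (cong (f zero ⊕_) (sym (identityʳ (f (suc zero))))) sum≡0)

  private
    length-allFin+length-elementsOfOrder≤2≡n+l : length (allFin n) + length elementsOfOrder≤2 ≡ n + l
    length-allFin+length-elementsOfOrder≤2≡n+l = cong₂ _+_ (length-tabulate id) (sym l≡length-elementsOfOrder≤2)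

  NoZeroSum₂⇒∣A∣≤[n+l]/2 : ∀ A → NoZeroSum 2 A → ∣ A ∣ ≤ (n + l) / 2
  NoZeroSum₂⇒∣A∣≤[n+l]/2 A A-zeroFree = begin
    ∣ A ∣              ≡⟨ m*n/n≡m ∣ A ∣ 2 ⟨
    ∣ A ∣ * 2 / 2      ≤⟨ /-monoˡ-≤ 2 ∣A∣*2≤n+l ⟩
    (n + l) / 2        ∎
    where
      open ℕ.≤-Reasoning
      no-pair : ∀ x → ⊖ x ≢ x → lookup A x ∧ lookup A (⊖ x) ≡ false
      no-pair x ⊖x≢x with lookup A x in x∈A | lookup A (⊖ x) in ⊖x∈A
      ... | true  | true  =
        contradiction A-zeroFree (zeroSumPair ⊖x≢x (lookup⇒[]= x A x∈A) (lookup⇒[]= (⊖ x) A ⊖x∈A))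
      ... | true  | false = refl
      ... | false | _     = refl
      ∣A∣*2≤n+l : ∣ A ∣ * 2 ≤ n + l
      ∣A∣*2≤n+l = subst₂ _≤_ (cong (_* 2) (sym (∣p∣≡length-filterᵇ A)))
                             length-allFin+length-elementsOfOrder≤2≡n+l
                             (length-filterᵇ-≤ (lookup A) no-pair)

  oneOfEachPair? : G → Bool
  oneOfEachPair? x = order≤2? x ∨ does (x <? ⊖ x)

  oneOfEachPair?-fixed : ∀ x → ⊖ x ≡ x → oneOfEachPair? x ≡ true
  oneOfEachPair?-fixed x ⊖x≡x = cong (_∨ does (x <? ⊖ x)) (order≤2?-fixed ⊖x≡x)

  oneOfEachPair?-moved : ∀ x → ⊖ x ≢ x → oneOfEachPair? (⊖ x) ≡ not (oneOfEachPair? x)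
  oneOfEachPair?-moved x ⊖x≢x = begin
    order≤2? (⊖ x) ∨ does (⊖ x <? ⊖ (⊖ x))   ≡⟨ cong (_∨ does (⊖ x <? ⊖ (⊖ x))) (order≤2?-moved (Negation.¬Fixed-φ ⊖x≢x)) ⟩
    does (⊖ x <? ⊖ (⊖ x))                    ≡⟨ cong (λ y → does (⊖ x <? y)) (⁻¹-involutive x) ⟩
    does (⊖ x <? x)                          ≡⟨ does-<?-flip (⊖x≢x ∘ sym) ⟩
    not (does (x <? ⊖ x))                    ≡⟨ cong (λ b → not (b ∨ does (x <? ⊖ x))) (order≤2?-moved ⊖x≢x) ⟨
    not (order≤2? x ∨ does (x <? ⊖ x))       ∎
    where open ≡-Reasoning

  OneOfEachPair : Subset n
  OneOfEachPair = tabulate oneOfEachPair?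

  OneOfEachPair-zeroFree : NoZeroSum 2 OneOfEachPair
  OneOfEachPair-zeroFree f f-inj f∈ sum≡0 with ⊖ (f zero) Fin.≟ f zero
  ... | yes ⊖x≡x = contradiction (f-inj (sym (trans (zeroSum⇒⊖ f sum≡0) ⊖x≡x))) λ ()
  ... | no  ⊖x≢x = contradiction false≡true λ ()
    where
      open ≡-Reasoning
      x = f zero
      false≡true : false ≡ true
      false≡true = begin
        false                               ≡⟨ cong not (∈-tabulate⁻ oneOfEachPair? (f∈ zero)) ⟨
        not (oneOfEachPair? x)             ≡⟨ oneOfEachPair?-moved x ⊖x≢x ⟨
        oneOfEachPair? (⊖ x)               ≡⟨ cong oneOfEachPair? (zeroSum⇒⊖ f sum≡0) ⟨
        oneOfEachPair? (f (suc zero))      ≡⟨ ∈-tabulate⁻ oneOfEachPair? (f∈ (suc zero)) ⟩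
        true                                ∎

  ∣OneOfEachPair∣ : ∣ OneOfEachPair ∣ ≡ (n + l) / 2
  ∣OneOfEachPair∣ = begin
    ∣ OneOfEachPair ∣            ≡⟨ m*n/n≡m ∣ OneOfEachPair ∣ 2 ⟨
    ∣ OneOfEachPair ∣ * 2 / 2    ≡⟨ cong (_/ 2) ∣A∣*2≡n+l ⟩
    (n + l) / 2                    ∎
    where
      open ≡-Reasoning
      ∣A∣*2≡n+l : ∣ OneOfEachPair ∣ * 2 ≡ n + l
      ∣A∣*2≡n+l = trans (cong (_* 2) (∣tabulate∣≡length-filterᵇ id oneOfEachPair?))
                   (trans (length-filterᵇ-≡ oneOfEachPair? oneOfEachPair?-fixed oneOfEachPair?-moved)
                          length-allFin+length-elementsOfOrder≤2≡n+l)

  Z₂≡[n+l]/2 : Zh≡ _⊕_ 0# 2 ((n + l) / 2)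
  Z₂≡[n+l]/2 = (OneOfEachPair , OneOfEachPair-zeroFree , ∣OneOfEachPair∣) , NoZeroSum₂⇒∣A∣≤[n+l]/2

  Zₙ₋₁≡n∸1 : 2 ≤ n → Zh≡ _⊕_ 0# m m
  Zₙ₋₁≡n∸1 2≤n with x , x≢∑G ← ∃≢ 2≤n ∑G =
    (∁ ⁅ x ⁆ , ∁⁅x⁆-zeroFree , ∣∁⁅x⁆∣≡n∸1 x) , ¬NoZeroSum⊤⇒∣A∣≤n∸1 ⊤-hasZeroSum
    where
      ∁⁅x⁆-zeroFree : NoZeroSum m (∁ ⁅ x ⁆)
      ∁⁅x⁆-zeroFree f f-inj f∈ sum≡0 = x≢∑G (begin
        x                                ≡⟨ identityʳ x ⟨
        x ⊕ 0#                           ≡⟨ cong (x ⊕_) sum≡0 ⟨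
        sumOf _⊕_ 0# n (x ∷ᵛ f)           ≡⟨ sumOf-injective≡∑G (x ∷ᵛ f) (∷-injective f-inj (∈∁⁅x⁆⇒≢ ∘ f∈)) ⟩
        ∑G                               ∎)
        where open ≡-Reasoning
      ⊤-hasZeroSum : ¬ NoZeroSum m ⊤
      ⊤-hasZeroSum ⊤-zeroFree =
        ⊤-zeroFree (punchIn ∑G) (Fin.punchIn-injective ∑G _ _) (λ _ → ∈⊤) sumOf[punchIn∑G]≡0#

  Zₙ≡n : l ≡ 2 → Zh≡ _⊕_ 0# n n
  Zₙ≡n l≡2 = (⊤ , ⊤-zeroFree , ∣⊤∣≡n n) , λ A _ → ∣p∣≤n A
    where
      ⊤-zeroFree : NoZeroSum n ⊤
      ⊤-zeroFree f f-inj _ sum≡0 = ∑G≢0# l≡2 (trans (sym (sumOf-injective≡∑G f f-inj)) sum≡0)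

  Zₙ≡n∸1 : l ≢ 2 → Zh≡ _⊕_ 0# n m
  Zₙ≡n∸1 l≢2 = (∁ ⁅ 0# ⁆ , ∁⁅0#⁆-zeroFree , ∣∁⁅x⁆∣≡n∸1 0#) , ¬NoZeroSum⊤⇒∣A∣≤n∸1 ⊤-hasZeroSum
    where
      ∁⁅0#⁆-zeroFree : NoZeroSum n (∁ ⁅ 0# ⁆)
      ∁⁅0#⁆-zeroFree f f-inj f∈ _ = injective⇒¬¬surjective f f-inj 0# (∈∁⁅x⁆⇒≢ ∘ f∈)
      ⊤-hasZeroSum : ¬ NoZeroSum n ⊤
      ⊤-hasZeroSum ⊤-zeroFree = ⊤-zeroFree id id (λ _ → ∈⊤) (∑G≡0# l≢2)

proposition4p1 : (n : ℕ) → 2 ≤ n →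
    (_⊕_ : Fin n → Fin n → Fin n) (0# : Fin n) (⊖_ : Fin n → Fin n) →
    IsAbelianGroup _≡_ _⊕_ 0# ⊖_ →
    Zh≡ _⊕_ 0# 1 (n ∸ 1)
    × Zh≡ _⊕_ 0# 2 ((n + ord≤2 _⊕_ 0#) / 2)
    × Zh≡ _⊕_ 0# (n ∸ 1) (n ∸ 1)
    × (ord≤2 _⊕_ 0# ≡ 2 → Zh≡ _⊕_ 0# n n)
    × (¬ (ord≤2 _⊕_ 0# ≡ 2) → Zh≡ _⊕_ 0# n (n ∸ 1))
proposition4p1 (suc m) 2≤n _⊕_ 0# ⊖_ isAbelianGroup =
  Z₁≡n∸1 , Z₂≡[n+l]/2 , Zₙ₋₁≡n∸1 2≤n , Zₙ≡n , Zₙ≡n∸1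
  where open RestrictedSumsets isAbelianGroup
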